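{- Let $n\ge1$, let $M$ be a pignose matching on $[2n]$ and let $k\ge0$ be an integer. Then $N=\big(\rho^{(2k+1)}(M)\big)^{\mathrm{rev}}$ is a pignose matching and $\operatorname{cro}(N)=\operatorname{cro}(M)$.
   Context: For a set $U$ of $2n$ integers, an ordered matching on $U$ is a set of ordered pairs $(i,j)$ such that each element of $U$ appears in exactly one pair. A pair $(i,j)$ is drawn as an arc between $i$ and $j$ on a horizontal line, above the line (upper arc) if $i<j$ and below (lower arc) if $i>j$. A crossing of an ordered matching is an unordered pair of its pairs whose underlying sets $\{a,b\},\{c,d\}$ satisfy $a<c<b<d$ and which are both upper arcs or both lower arcs; $\operatorname{cro}(M)$ is the number of crossings. The standardization $\operatorname{st}(M)$ of an ordered matching on $U=\{a_1<\dots<a_{2n}\}$ replaces each $a_i$ by $i$. For an ordered matching $M$ on $[2n]$, $\rho(M)=\operatorname{st}(M')$ where $M'$ is obtained from $M$ by replacing the integer $1$ by $2n+1$; $\rho^{(m)}$ denotes the $m$-fold iterate. $M^{\mathrm{rev}}$ is obtained from $M$ by replacing each $i$ by $2n+1-i$. A pignose matching on $[2n]$ is an ordered matching of the form $\{(2i-1,2\sigma(i)):i\in[n]\}$ for some permutation $\sigma$ of $[n]$. -}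

module Defs where

open import Data.Nat using (ℕ; zero; suc; _+_; _*_; _∸_; _<ᵇ_; _≡ᵇ_; _≤ᵇ_)
open import Data.Bool using (Bool; true; false; if_then_else_; _∧_; _∨_)
open import Data.List using (List; []; _∷_; map; length; concatMap; filter; sum)
open import Data.Product using (_×_; _,_; proj₁; proj₂; ∃-syntax)
open import Data.Fin using (Fin; toℕ)
open import Data.List using (allFin)
open import Data.Fin.Permutation using (Permutation′; _⟨$⟩ʳ_)
open import Data.List.Relation.Binary.Permutation.Propositional using (_↭_)

-- An ordered matching is represented by the list of its ordered pairs (i , j)
-- (a finite set of pairs; the order of the list is irrelevant, and
-- set equality of matchings is expressed by list permutation _↭_).
OrderedMatching : Set
OrderedMatching = List (ℕ × ℕ)

support : OrderedMatching → List ℕ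
support = concatMap (λ p → proj₁ p ∷ proj₂ p ∷ [])

count : List Bool → ℕ
count [] = 0
count (true ∷ bs) = suc (count bs)
count (false ∷ bs) = count bs

-- standardization: replace a_i (the i-th smallest element of U) by i,
-- i.e. x ↦ #{ u ∈ U : u ≤ x }
st : OrderedMatching → OrderedMatching
st M = map (λ p → rank (proj₁ p) , rank (proj₂ p)) M
  where
  rank : ℕ → ℕ
  rank x = count (map (λ u → u ≤ᵇ x) (support M))

-- for a matching on [2n], n is the number of pairs
-- rho(M) = st(M') with M' obtained by replacing 1 by 2n+1
ρ : OrderedMatching → OrderedMatching
ρ M = st (map (λ p → repl (proj₁ p) , repl (proj₂ p)) M)
  where
  repl : ℕ → ℕ
  repl x = if x ≡ᵇ 1 then 2 * length M + 1 else x

iter : {A : Set} → ℕ → (A → A) → A → A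
iter zero f x = x
iter (suc m) f x = f (iter m f x)

rev : OrderedMatching → OrderedMatching
rev M = map (λ p → r (proj₁ p) , r (proj₂ p)) M
  where
  r : ℕ → ℕ
  r i = (2 * length M + 1) ∸ i

upper : ℕ × ℕ → Bool
upper (i , j) = i <ᵇ j

lo hi : ℕ × ℕ → ℕ
lo (i , j) = if i <ᵇ j then i else j
hi (i , j) = if i <ᵇ j then j else i

crosses : ℕ × ℕ → ℕ × ℕ → Bool
crosses p q =
  (((lo p <ᵇ lo q) ∧ (lo q <ᵇ hi p) ∧ (hi p <ᵇ hi q))
   ∨ ((lo q <ᵇ lo p) ∧ (lo p <ᵇ hi q) ∧ (hi q <ᵇ hi p)))
  ∧ sameOrient
  where
  sameOrient : Bool
  sameOrient with upper p | upper q
  ... | true  | true  = true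
  ... | false | false = true
  ... | _     | _     = false

cro : OrderedMatching → ℕ
cro [] = 0
cro (p ∷ M) = count (map (crosses p) M) + cro M

-- the pignose matching {(2i-1, 2σ(i)) : i ∈ [n]}  (i 0-indexed in Fin n)
pignoseOf : (n : ℕ) → Permutation′ n → OrderedMatching
pignoseOf n σ = map (λ i → (2 * toℕ i + 1) , (2 * suc (toℕ (σ ⟨$⟩ʳ i)))) (allFin n)

IsPignose : ℕ → OrderedMatching → Set
IsPignose n M = ∃[ σ ] (M ↭ pignoseOf n σ)

-- On a matching of [2n], ρ acts as the cyclic relabelling x ↦ x − 1 (with 1 ↦ 2n) and rev as
-- x ↦ 2n + 1 − x. Both exchange odd and even points, so they carry a pignose matching (arcs from
-- odd to even points) to a swapped one (arcs from even to odd points) and back, with an explicitly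
-- computed permutation; hence an odd number of rotations followed by rev yields a pignose matching.
-- Reflecting and swapping all arcs preserve crossings, and so does a rotation here: it only turns
-- the arc (1 , Y) into (2n , Y − 1), trading the upper arcs straddling Y for the lower ones, and
-- their numbers differ by the number of other arcs starting below Y minus those ending below Y,
-- which vanishes because the points 2, …, Y − 1 alternate between ends and starts.

module Submission where

open import Data.Bool using (Bool; true; false; not; _∧_; _∨_; T; if_then_else_)
open import Data.Bool.Properties using (∧-identityʳ; ∧-zeroʳ; ∧-comm; ∧-assoc; ∨-comm; ∨-identityʳ)
open import Data.Empty using (⊥-elim)
open import Data.Fin using (Fin; toℕ; opposite) renaming (zero to fzero; suc to fsuc)
open import Data.Fin.Permutation
  using (Permutation′; _⟨$⟩ʳ_; _⟨$⟩ˡ_; inverseˡ; inverseʳ; _∘ₚ_; flip; lift₀; reverse)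
  renaming (id to idₚ)
open import Data.Fin.Properties
  using (toℕ<n; toℕ-injective; toℕ-fromℕ; toℕ-inject₁; opposite-prop; opposite-involutive)
open import Data.List using (List; []; _∷_; _++_; _∷ʳ_; map; length; allFin; tabulate)
open import Data.List.Properties using (map-∘; map-id; map-cong; map-cong-local; map-tabulate; tabulate-cong)
open import Data.List.Membership.Propositional using (_∈_)
open import Data.List.Membership.Propositional.Properties using (∈-allFin; ∈-map⁺)
open import Data.List.Membership.Propositional.Properties.WithK using (unique∧set⇒bag)
open import Data.List.Relation.Binary.BagAndSetEquality using (∼bag⇒↭)
open import Data.List.Relation.Binary.Permutation.Propositional as Perm
  using (_↭_; prep; ↭-refl; ↭-sym; ↭-trans; ↭-reflexive; module PermutationReasoning)
open import Data.List.Relation.Binary.Permutation.Propositional.Properties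
  using (map⁺; ++⁺ˡ; ++-comm; shift; shifts; ↭-length; ∷↭∷ʳ; All-resp-↭)
open import Data.List.Relation.Unary.All as All using (All; []; _∷_)
import Data.List.Relation.Unary.All.Properties as All
open import Data.List.Relation.Unary.Unique.Propositional.Properties as Unique using (allFin⁺)
open import Data.Nat
  using (ℕ; zero; suc; parity; _+_; _*_; _∸_; _<ᵇ_; _≡ᵇ_; _≤ᵇ_; _≤_; _<_; z≤n; s≤s; _<?_)
open import Data.Nat.Properties
open import Algebra.Properties.CommutativeSemigroup +-commutativeSemigroup using (interchange)
open import Data.Nat.Tactic.RingSolver using (solve-∀)
open import Data.Parity.Base as ℙ using (0ℙ; 1ℙ)
open import Data.Parity.Properties using (+-homo-+; *-homo-*)
open import Data.Product using (_×_; _,_; proj₁; proj₂; swap)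
open import Function.Base using (case_of_)
open import Function.Bundles using (mk⇔)
open import Relation.Binary.Definitions using (tri<; tri≈; tri>)
open import Relation.Binary.PropositionalEquality
open import Relation.Nullary using (yes; no)

open import Defs

bit : Bool → ℕ
bit true = 1
bit false = 0

count-∷ : ∀ b bs → count (b ∷ bs) ≡ bit b + count bs
count-∷ true bs = refl
count-∷ false bs = refl

count-↭ : ∀ {bs cs} → bs ↭ cs → count bs ≡ count cs
count-↭ Perm.refl = refl
count-↭ (prep true p) = cong suc (count-↭ p)
count-↭ (prep false p) = count-↭ p
count-↭ (Perm.swap true true p) = cong (2 +_) (count-↭ p)
count-↭ (Perm.swap true false p) = cong suc (count-↭ p)
count-↭ (Perm.swap false true p) = cong suc (count-↭ p)
count-↭ (Perm.swap false false p) = count-↭ p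
count-↭ (Perm.trans p q) = trans (count-↭ p) (count-↭ q)

count-map-↭ : ∀ {A : Set} (f : A → Bool) {xs ys} → xs ↭ ys → count (map f xs) ≡ count (map f ys)
count-map-↭ f p = count-↭ (map⁺ f p)

count-map-cong : ∀ {A : Set} {f g : A → Bool} {xs} → All (λ x → f x ≡ g x) xs →
  count (map f xs) ≡ count (map g xs)
count-map-cong eqs = cong count (map-cong-local eqs)

true⇒< : ∀ {a b} → (a <ᵇ b) ≡ true → a < b
true⇒< {a} {b} eq = <ᵇ⇒< a b (subst T (sym eq) _)

false⇒≥ : ∀ {a b} → (a <ᵇ b) ≡ false → b ≤ a
false⇒≥ eq = ≮⇒≥ (λ a<b → subst T eq (<⇒<ᵇ a<b))

<ᵇ-true : ∀ {a b} → a < b → (a <ᵇ b) ≡ true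
<ᵇ-true {a} {b} a<b with a <ᵇ b | <⇒<ᵇ a<b
... | true | _ = refl

<ᵇ-false : ∀ {a b} → b ≤ a → (a <ᵇ b) ≡ false
<ᵇ-false {a} {b} b≤a with a <ᵇ b in eq
... | true = ⊥-elim (<⇒≱ (true⇒< eq) b≤a)
... | false = refl

<ᵇ-cong : ∀ {a b c d} → (a < b → c < d) → (c < d → a < b) → (a <ᵇ b) ≡ (c <ᵇ d)
<ᵇ-cong {a} {b} {c} {d} to from with c <? d
... | yes c<d = trans (<ᵇ-true (from c<d)) (sym (<ᵇ-true c<d))
... | no c≮d = trans (<ᵇ-false (≮⇒≥ (λ a<b → c≮d (to a<b)))) (sym (<ᵇ-false (≮⇒≥ c≮d)))

-- Crossings

alternate : ℕ → ℕ → ℕ → ℕ → Bool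
alternate a b c d = ((a <ᵇ c) ∧ (c <ᵇ b) ∧ (b <ᵇ d)) ∨ ((c <ᵇ a) ∧ (a <ᵇ d) ∧ (d <ᵇ b))

alternate-sym : ∀ a b c d → alternate a b c d ≡ alternate c d a b
alternate-sym a b c d = ∨-comm ((a <ᵇ c) ∧ (c <ᵇ b) ∧ (b <ᵇ d)) _

agree : Bool → Bool → Bool
agree true true = true
agree false false = true
agree _ _ = false

crosses-unfold : ∀ p q → crosses p q ≡ alternate (lo p) (hi p) (lo q) (hi q) ∧ agree (upper p) (upper q)
crosses-unfold p q with upper p | upper q
... | true | true = refl
... | true | false = refl
... | false | true = refl
... | false | false = refl

agree-comm : ∀ u v → agree u v ≡ agree v u
agree-comm true true = refl
agree-comm true false = refl
agree-comm false true = refl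
agree-comm false false = refl

agree-not : ∀ u v → agree (not u) (not v) ≡ agree u v
agree-not true true = refl
agree-not true false = refl
agree-not false true = refl
agree-not false false = refl

crosses-sym : ∀ p q → crosses p q ≡ crosses q p
crosses-sym p q = begin
  crosses p q
    ≡⟨ crosses-unfold p q ⟩
  alternate (lo p) (hi p) (lo q) (hi q) ∧ agree (upper p) (upper q)
    ≡⟨ cong₂ _∧_ (alternate-sym (lo p) (hi p) (lo q) (hi q)) (agree-comm (upper p) (upper q)) ⟩
  alternate (lo q) (hi q) (lo p) (hi p) ∧ agree (upper q) (upper p)
    ≡⟨ crosses-unfold q p ⟨
  crosses q p ∎
  where open ≡-Reasoning

data Oriented (a b : ℕ) : Set where
  ascending : (a <ᵇ b) ≡ true → (b <ᵇ a) ≡ false → Oriented a b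
  descending : (a <ᵇ b) ≡ false → (b <ᵇ a) ≡ true → Oriented a b

oriented : ∀ {a b} → a ≢ b → Oriented a b
oriented {a} {b} a≢b with <-cmp a b
... | tri< a<b _ _ = ascending (<ᵇ-true a<b) (<ᵇ-false (<⇒≤ a<b))
... | tri≈ _ a≡b _ = ⊥-elim (a≢b a≡b)
... | tri> _ _ b<a = descending (<ᵇ-false (<⇒≤ b<a)) (<ᵇ-true b<a)

crosses-swap : ∀ {a b c d} → a ≢ b → c ≢ d → crosses (b , a) (d , c) ≡ crosses (a , b) (c , d)
crosses-swap {a} {b} {c} {d} a≢b c≢d with oriented a≢b | oriented c≢d
... | ascending p q | ascending r s rewrite p | q | r | s = refl
... | ascending p q | descending r s rewrite p | q | r | s = refl
... | descending p q | ascending r s rewrite p | q | r | s = refl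
... | descending p q | descending r s rewrite p | q | r | s = refl

∧-reverse₃ : ∀ x y z → x ∧ y ∧ z ≡ z ∧ y ∧ x
∧-reverse₃ x y z = trans (∧-comm x (y ∧ z)) (trans (cong (_∧ x) (∧-comm y z)) (∧-assoc z y x))

flip-<ᵇ : ∀ {K x y} → x ≤ K → y ≤ K → ((K ∸ x) <ᵇ (K ∸ y)) ≡ (y <ᵇ x)
flip-<ᵇ x≤K y≤K = <ᵇ-cong ∸-cancelʳ-< (λ y<x → ∸-monoʳ-< y<x x≤K)

alternate-reflect : ∀ {K a b c d} → a ≤ K → b ≤ K → c ≤ K → d ≤ K →
  alternate (K ∸ b) (K ∸ a) (K ∸ d) (K ∸ c) ≡ alternate a b c d
alternate-reflect {K} {a} {b} {c} {d} ha hb hc hd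
  rewrite flip-<ᵇ {K} hb hd | flip-<ᵇ {K} hd ha | flip-<ᵇ {K} ha hc
        | flip-<ᵇ {K} hd hb | flip-<ᵇ {K} hb hc | flip-<ᵇ {K} hc ha
  = trans (cong₂ _∨_ (∧-reverse₃ (d <ᵇ b) (a <ᵇ d) (c <ᵇ a)) (∧-reverse₃ (b <ᵇ d) (c <ᵇ b) (a <ᵇ c)))
          (∨-comm ((c <ᵇ a) ∧ (a <ᵇ d) ∧ (d <ᵇ b)) _)

module _ {K a b : ℕ} (a≢b : a ≢ b) (a≤K : a ≤ K) (b≤K : b ≤ K) where

  lo-reflect : lo (K ∸ a , K ∸ b) ≡ K ∸ hi (a , b)
  lo-reflect with oriented a≢b
  ... | ascending p q rewrite flip-<ᵇ {K} a≤K b≤K | p | q = refl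
  ... | descending p q rewrite flip-<ᵇ {K} a≤K b≤K | p | q = refl

  hi-reflect : hi (K ∸ a , K ∸ b) ≡ K ∸ lo (a , b)
  hi-reflect with oriented a≢b
  ... | ascending p q rewrite flip-<ᵇ {K} a≤K b≤K | p | q = refl
  ... | descending p q rewrite flip-<ᵇ {K} a≤K b≤K | p | q = refl

  upper-reflect : upper (K ∸ a , K ∸ b) ≡ not (upper (a , b))
  upper-reflect with oriented a≢b
  ... | ascending p q rewrite flip-<ᵇ {K} a≤K b≤K | p | q = refl
  ... | descending p q rewrite flip-<ᵇ {K} a≤K b≤K | p | q = refl

lo≤ : ∀ {K a b} → a ≤ K → b ≤ K → lo (a , b) ≤ K
lo≤ {a = a} {b} ha hb with a <ᵇ b
... | true = ha
... | false = hb

hi≤ : ∀ {K a b} → a ≤ K → b ≤ K → hi (a , b) ≤ K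
hi≤ {a = a} {b} ha hb with a <ᵇ b
... | true = hb
... | false = ha

crosses-reflect : ∀ {K a b c d} → a ≢ b → c ≢ d → a ≤ K → b ≤ K → c ≤ K → d ≤ K →
  crosses (K ∸ a , K ∸ b) (K ∸ c , K ∸ d) ≡ crosses (a , b) (c , d)
crosses-reflect {K} {a} {b} {c} {d} a≢b c≢d ha hb hc hd = begin
  crosses (K ∸ a , K ∸ b) (K ∸ c , K ∸ d)
    ≡⟨ crosses-unfold (K ∸ a , K ∸ b) (K ∸ c , K ∸ d) ⟩
  alternate (lo p′) (hi p′) (lo q′) (hi q′) ∧ agree (upper p′) (upper q′)
    ≡⟨ cong₂ _∧_ (cong₂ (λ x y → alternate x y (lo q′) (hi q′)) (lo-reflect a≢b ha hb) (hi-reflect a≢b ha hb))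
                 (cong₂ agree (upper-reflect a≢b ha hb) (upper-reflect c≢d hc hd)) ⟩
  alternate (K ∸ hi p) (K ∸ lo p) (lo q′) (hi q′) ∧ agree (not (upper p)) (not (upper q))
    ≡⟨ cong₂ _∧_ (cong₂ (alternate (K ∸ hi p) (K ∸ lo p)) (lo-reflect c≢d hc hd) (hi-reflect c≢d hc hd))
                 (agree-not (upper p) (upper q)) ⟩
  alternate (K ∸ hi p) (K ∸ lo p) (K ∸ hi q) (K ∸ lo q) ∧ agree (upper p) (upper q)
    ≡⟨ cong (_∧ agree (upper p) (upper q)) (alternate-reflect (lo≤ ha hb) (hi≤ ha hb) (lo≤ hc hd) (hi≤ hc hd)) ⟩
  alternate (lo p) (hi p) (lo q) (hi q) ∧ agree (upper p) (upper q)
    ≡⟨ crosses-unfold p q ⟨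
  crosses p q ∎
  where
  open ≡-Reasoning
  p q p′ q′ : ℕ × ℕ
  p = (a , b)
  q = (c , d)
  p′ = (K ∸ a , K ∸ b)
  q′ = (K ∸ c , K ∸ d)

crosses-pred : ∀ a b c d → crosses (suc a , suc b) (suc c , suc d) ≡ crosses (a , b) (c , d)
crosses-pred a b c d with a <ᵇ b | c <ᵇ d
... | true | true = refl
... | true | false = refl
... | false | true = refl
... | false | false = refl

nothing-between : ∀ {s y e} → e ≤ s → ((s <ᵇ y) ∧ (y <ᵇ e)) ≡ false
nothing-between {s} {y} e≤s with s <ᵇ y in eq
... | true = <ᵇ-false (≤-trans e≤s (<⇒≤ (true⇒< eq)))
... | false = refl

crosses-from-min : ∀ {z y s e} → z < y → z < s → z < e →
  crosses (z , y) (s , e) ≡ (s <ᵇ y) ∧ (y <ᵇ e)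
crosses-from-min {z} {y} {s} {e} z<y z<s z<e
  rewrite crosses-unfold (z , y) (s , e) | <ᵇ-true z<y with s <ᵇ e in s?e
... | true rewrite <ᵇ-true z<s | <ᵇ-false (<⇒≤ z<s) = trans (∧-identityʳ _) (∨-identityʳ _)
... | false = trans (∧-zeroʳ _) (sym (nothing-between {s} {y} {e} (false⇒≥ s?e)))

crosses-from-max : ∀ {w y s e} → y < w → s < w → e < w →
  crosses (w , y) (s , e) ≡ (e <ᵇ y) ∧ (y <ᵇ s)
crosses-from-max {w} {y} {s} {e} y<w s<w e<w
  rewrite crosses-unfold (w , y) (s , e) | <ᵇ-false {w} {y} (<⇒≤ y<w) with s <ᵇ e in s?e
... | true = trans (∧-zeroʳ _) (sym (nothing-between {e} {y} {s} (<⇒≤ (true⇒< s?e))))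
... | false rewrite <ᵇ-true e<w | <ᵇ-false {w} {s} (<⇒≤ s<w) | <ᵇ-true s<w | ∧-zeroʳ (y <ᵇ e)
                  | ∧-identityʳ (y <ᵇ s) = ∧-identityʳ _

-- Crossing numbers

cro-↭ : ∀ {M N} → M ↭ N → cro M ≡ cro N
cro-↭ Perm.refl = refl
cro-↭ (prep p M↭N) = cong₂ _+_ (count-map-↭ (crosses p) M↭N) (cro-↭ M↭N)
cro-↭ {x ∷ y ∷ M} {.y ∷ .x ∷ N} (Perm.swap x y M↭N) = begin
  cro (x ∷ y ∷ M)
    ≡⟨ cong (_+ _) (count-∷ (crosses x y) _) ⟩
  (bit (crosses x y) + count (map (crosses x) M)) + (count (map (crosses y) M) + cro M)
    ≡⟨ interchange (bit (crosses x y)) _ _ _ ⟩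
  (bit (crosses x y) + count (map (crosses y) M)) + (count (map (crosses x) M) + cro M)
    ≡⟨ cong₂ (λ b c → (bit b + c) + _) (crosses-sym x y) (count-map-↭ (crosses y) M↭N) ⟩
  (bit (crosses y x) + count (map (crosses y) N)) + (count (map (crosses x) M) + cro M)
    ≡⟨ cong ((bit (crosses y x) + count (map (crosses y) N)) +_)
            (cong₂ _+_ (count-map-↭ (crosses x) M↭N) (cro-↭ M↭N)) ⟩
  (bit (crosses y x) + count (map (crosses y) N)) + (count (map (crosses x) N) + cro N)
    ≡⟨ cong (_+ _) (count-∷ (crosses y x) _) ⟨
  cro (y ∷ x ∷ N) ∎
  where open ≡-Reasoning
cro-↭ (Perm.trans L↭M M↭N) = trans (cro-↭ L↭M) (cro-↭ M↭N)

cro-map : ∀ (Q : ℕ × ℕ → Set) (g : ℕ × ℕ → ℕ × ℕ) →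
  (∀ {p q} → Q p → Q q → crosses (g p) (g q) ≡ crosses p q) →
  ∀ {M} → All Q M → cro (map g M) ≡ cro M
cro-map Q g g-crosses [] = refl
cro-map Q g g-crosses {p ∷ M} (Qp ∷ QM) = cong₂ _+_ count-eq (cro-map Q g g-crosses QM)
  where
  count-eq : count (map (crosses (g p)) (map g M)) ≡ count (map (crosses p) M)
  count-eq = trans (cong count (sym (map-∘ M))) (count-map-cong (All.map (g-crosses Qp) QM))

<ᵇ-flip : ∀ {a b} → a ≢ b → (b <ᵇ a) ≡ not (a <ᵇ b)
<ᵇ-flip a≢b with oriented a≢b
... | ascending p q rewrite p | q = refl
... | descending p q rewrite p | q = refl

-- An arc avoiding y starts below y iff it ends below y, unless it straddles y upwards or downwards.
straddle-balance : ∀ y R → All (λ r → proj₁ r ≢ y × proj₂ r ≢ y) R →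
  count (map (λ r → (proj₁ r <ᵇ y) ∧ (y <ᵇ proj₂ r)) R) + count (map (λ r → proj₂ r <ᵇ y) R)
  ≡ count (map (λ r → (proj₂ r <ᵇ y) ∧ (y <ᵇ proj₁ r)) R) + count (map (λ r → proj₁ r <ᵇ y) R)
straddle-balance y [] [] = refl
straddle-balance y ((s , e) ∷ R) ((s≢y , e≢y) ∷ avoid) = begin
  count (up ∷ map U R) + count (eb ∷ map E R)
    ≡⟨ cong₂ _+_ (count-∷ up _) (count-∷ eb _) ⟩
  (bit up + count (map U R)) + (bit eb + count (map E R))
    ≡⟨ interchange (bit up) _ _ _ ⟩
  (bit up + bit eb) + (count (map U R) + count (map E R))
    ≡⟨ cong₂ _+_ single (straddle-balance y R avoid) ⟩
  (bit down + bit sb) + (count (map L R) + count (map S R))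
    ≡⟨ interchange (bit down) _ _ _ ⟩
  (bit down + count (map L R)) + (bit sb + count (map S R))
    ≡⟨ cong₂ _+_ (count-∷ down _) (count-∷ sb _) ⟨
  count (down ∷ map L R) + count (sb ∷ map S R) ∎
  where
  open ≡-Reasoning
  U L S E : ℕ × ℕ → Bool
  U r = (proj₁ r <ᵇ y) ∧ (y <ᵇ proj₂ r)
  L r = (proj₂ r <ᵇ y) ∧ (y <ᵇ proj₁ r)
  S r = proj₁ r <ᵇ y
  E r = proj₂ r <ᵇ y
  up down sb eb : Bool
  up = U (s , e)
  down = L (s , e)
  sb = S (s , e)
  eb = E (s , e)
  single : bit up + bit eb ≡ bit down + bit sb
  single rewrite <ᵇ-flip e≢y | <ᵇ-flip s≢y with s <ᵇ y | e <ᵇ y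
  ... | true | true = refl
  ... | true | false = refl
  ... | false | true = refl
  ... | false | false = refl

-- Rotation

relabel : (ℕ → ℕ) → OrderedMatching → OrderedMatching
relabel f = map (λ p → f (proj₁ p) , f (proj₂ p))

Both : (ℕ → Set) → ℕ × ℕ → Set
Both P (a , b) = P a × P b

replaceOne : ℕ → ℕ → ℕ
replaceOne n x = if x ≡ᵇ 1 then 2 * n + 1 else x

rotate : ℕ → ℕ → ℕ
rotate n x = replaceOne n x ∸ 1

rotate-one : ∀ n → rotate n 1 ≡ 2 * n
rotate-one n = m+n∸n≡m (2 * n) 1

crosses-rotate : ∀ {n a b c d} → 1 < a → 1 < b → 1 < c → 1 < d →
  crosses (rotate n a , rotate n b) (rotate n c , rotate n d) ≡ crosses (a , b) (c , d)
crosses-rotate {a = suc (suc a)} {suc (suc b)} {suc (suc c)} {suc (suc d)}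
  (s≤s (s≤s z≤n)) (s≤s (s≤s z≤n)) (s≤s (s≤s z≤n)) (s≤s (s≤s z≤n)) =
  sym (crosses-pred (suc a) (suc b) (suc c) (suc d))

crosses-rotate-one : ∀ {n Y s e} → 1 < Y → 1 < s → 1 < e → Y ≤ 2 * n → s ≤ 2 * n → e ≤ 2 * n →
  crosses (rotate n 1 , rotate n Y) (rotate n s , rotate n e) ≡ (e <ᵇ Y) ∧ (Y <ᵇ s)
crosses-rotate-one {n} (s≤s (s≤s z≤n)) (s≤s (s≤s z≤n)) (s≤s (s≤s z≤n)) Y≤2n s≤2n e≤2n
  rewrite rotate-one n = crosses-from-max Y≤2n s≤2n e≤2n

InnerPoint : ℕ → ℕ → ℕ → Set
InnerPoint n Y x = 1 < x × x ≤ 2 * n × x ≢ Y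

cro-rotate : ∀ n {Y} R → 1 < Y → Y ≤ 2 * n → All (Both (InnerPoint n Y)) R →
  count (map (λ r → proj₁ r <ᵇ Y) R) ≡ count (map (λ r → proj₂ r <ᵇ Y) R) →
  cro (relabel (rotate n) ((1 , Y) ∷ R)) ≡ cro ((1 , Y) ∷ R)
cro-rotate n {Y} R 1<Y Y≤2n inner balanced = begin
  count (map (crosses (rotate n 1 , rotate n Y)) (relabel (rotate n) R)) + cro (relabel (rotate n) R)
    ≡⟨ cong₂ _+_ (trans (cong count (sym (map-∘ R))) (count-map-cong (All.map after inner)))
                 (cro-map (Both (1 <_)) _ (λ (1<a , 1<b) (1<c , 1<d) → crosses-rotate {n} 1<a 1<b 1<c 1<d)
                          (All.map (λ ((1<s , _) , (1<e , _)) → 1<s , 1<e) inner)) ⟩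
  count (map L R) + cro R
    ≡⟨ cong (_+ cro R) (sym U≡L) ⟩
  count (map U R) + cro R
    ≡⟨ cong (_+ cro R) (sym (count-map-cong (All.map before inner))) ⟩
  cro ((1 , Y) ∷ R) ∎
  where
  open ≡-Reasoning
  U L : ℕ × ℕ → Bool
  U r = (proj₁ r <ᵇ Y) ∧ (Y <ᵇ proj₂ r)
  L r = (proj₂ r <ᵇ Y) ∧ (Y <ᵇ proj₁ r)
  before : ∀ {r} → Both (InnerPoint n Y) r → crosses (1 , Y) r ≡ U r
  before ((1<s , _) , (1<e , _)) = crosses-from-min 1<Y 1<s 1<e
  after : ∀ {r} → Both (InnerPoint n Y) r →
    crosses (rotate n 1 , rotate n Y) (rotate n (proj₁ r) , rotate n (proj₂ r)) ≡ L r
  after ((1<s , s≤2n , _) , (1<e , e≤2n , _)) = crosses-rotate-one {n} 1<Y 1<s 1<e Y≤2n s≤2n e≤2n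
  U≡L : count (map U R) ≡ count (map L R)
  U≡L = +-cancelʳ-≡ _ _ _ (trans (straddle-balance Y R (All.map avoids-Y inner)) (cong (count (map L R) +_) balanced))
    where
    avoids-Y : ∀ {r} → Both (InnerPoint n Y) r → proj₁ r ≢ Y × proj₂ r ≢ Y
    avoids-Y ((_ , _ , s≢Y) , (_ , _ , e≢Y)) = s≢Y , e≢Y

-- ρ and rev on matchings of [2n]

rank : OrderedMatching → ℕ → ℕ
rank M x = count (map (λ u → u ≤ᵇ x) (support M))

support-↭ : ∀ {M N} → M ↭ N → support M ↭ support N
support-↭ Perm.refl = ↭-refl
support-↭ (prep (a , b) M↭N) = prep a (prep b (support-↭ M↭N))
support-↭ {(a , b) ∷ (c , d) ∷ M} (Perm.swap _ _ M↭N) =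
  ↭-trans (shifts (a ∷ b ∷ []) (c ∷ d ∷ []) {support M}) (++⁺ˡ (c ∷ d ∷ a ∷ b ∷ []) (support-↭ M↭N))
support-↭ (Perm.trans L↭M M↭N) = ↭-trans (support-↭ L↭M) (support-↭ M↭N)

st-↭ : ∀ {M N} → M ↭ N → st M ↭ st N
st-↭ {M} {N} M↭N =
  ↭-trans (↭-reflexive (map-cong (λ p → cong₂ _,_ (same-rank (proj₁ p)) (same-rank (proj₂ p))) M)) (map⁺ _ M↭N)
  where
  same-rank : ∀ x → rank M x ≡ rank N x
  same-rank x = count-map-↭ (λ u → u ≤ᵇ x) (support-↭ M↭N)

ρ-↭ : ∀ {M N} → M ↭ N → ρ M ↭ ρ N
ρ-↭ {M} {N} M↭N rewrite ↭-length M↭N = st-↭ (map⁺ _ M↭N)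

rev-↭ : ∀ {M N} → M ↭ N → rev M ↭ rev N
rev-↭ {M} {N} M↭N rewrite ↭-length M↭N = map⁺ _ M↭N

iter-ρ-↭ : ∀ m {M N} → M ↭ N → iter m ρ M ↭ iter m ρ N
iter-ρ-↭ zero M↭N = M↭N
iter-ρ-↭ (suc m) M↭N = ρ-↭ (iter-ρ-↭ m M↭N)

range : ℕ → ℕ → List ℕ
range a zero = []
range a (suc l) = a ∷ range (suc a) l

range-snoc : ∀ a l → range a (suc l) ≡ range a l ∷ʳ (a + l)
range-snoc a zero = cong (_∷ []) (sym (+-identityʳ a))
range-snoc a (suc l) = cong (a ∷_) (trans (range-snoc (suc a) l) (cong (range (suc a) l ∷ʳ_) (sym (+-suc a l))))

range-bounds : ∀ a l → All (λ x → a ≤ x × x < a + l) (range a l)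
range-bounds a zero = []
range-bounds a (suc l) =
  (≤-refl , subst (a <_) (sym (+-suc a l)) (s≤s (m≤m+n a l)))
  ∷ All.map (λ {x} (a<x , x<) → <⇒≤ a<x , subst (x <_) (sym (+-suc a l)) x<) (range-bounds (suc a) l)

≤ᵇ-<ᵇ : ∀ u y → (u ≤ᵇ y) ≡ (u <ᵇ suc y)
≤ᵇ-<ᵇ zero y = refl
≤ᵇ-<ᵇ (suc u) y = refl

count-≤ᵇ-range : ∀ a d e → count (map (λ u → u ≤ᵇ a + d) (range (suc a) (d + e))) ≡ d
count-≤ᵇ-range a zero e = none (suc a) e (s≤s (≤-reflexive (+-identityʳ a)))
  where
  none : ∀ b l → a + 0 < b → count (map (λ u → u ≤ᵇ a + 0) (range b l)) ≡ 0
  none b zero _ = refl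
  none b (suc l) a<b rewrite ≤ᵇ-<ᵇ b (a + 0) | <ᵇ-false {b} {suc (a + 0)} a<b = none (suc b) l (m<n⇒m<1+n a<b)
count-≤ᵇ-range a (suc d) e
  rewrite +-suc a d | ≤ᵇ-<ᵇ (suc a) (suc (a + d)) | <ᵇ-true {suc a} {suc (suc (a + d))} (s≤s (s≤s (m≤m+n a d)))
  = cong suc (count-≤ᵇ-range (suc a) d e)

rank-range : ∀ L y → 1 ≤ y → y ≤ suc L → count (map (λ u → u ≤ᵇ y) (range 2 L)) ≡ y ∸ 1
rank-range L (suc d) _ (s≤s d≤L) =
  subst (λ l → count (map (λ u → u ≤ᵇ suc d) (range 2 l)) ≡ d) (m+[n∸m]≡n d≤L) (count-≤ᵇ-range 1 d (L ∸ d))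

MatchingOn : ℕ → OrderedMatching → Set
MatchingOn n M = support M ↭ range 1 (2 * n)

length-range : ∀ a l → length (range a l) ≡ l
length-range a zero = refl
length-range a (suc l) = cong suc (length-range (suc a) l)

length-support : ∀ M → length (support M) ≡ 2 * length M
length-support [] = refl
length-support (p ∷ M) = trans (cong (2 +_) (length-support M)) (sym (*-suc 2 (length M)))

matchingOn-length : ∀ {n M} → MatchingOn n M → length M ≡ n
matchingOn-length {n} {M} on =
  *-cancelˡ-≡ (length M) n 2 (trans (sym (length-support M)) (trans (↭-length on) (length-range 1 (2 * n))))

All-support⁻ : ∀ {P : ℕ → Set} M → All P (support M) → All (Both P) M
All-support⁻ [] [] = []
All-support⁻ (p ∷ M) (Pa ∷ Pb ∷ PM) = (Pa , Pb) ∷ All-support⁻ M PM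

matchingOn-bounds : ∀ {n M} → MatchingOn n M → All (Both (λ x → 1 ≤ x × x < 1 + 2 * n)) M
matchingOn-bounds {n} {M} on = All-support⁻ M (All-resp-↭ (↭-sym on) (range-bounds 1 (2 * n)))

support-relabel : ∀ f M → support (relabel f M) ≡ map f (support M)
support-relabel f [] = refl
support-relabel f (p ∷ M) = cong (λ xs → f (proj₁ p) ∷ f (proj₂ p) ∷ xs) (support-relabel f M)

replaceOne-range-from-2 : ∀ n a l → map (replaceOne n) (range (2 + a) l) ≡ range (2 + a) l
replaceOne-range-from-2 n a zero = refl
replaceOne-range-from-2 n a (suc l) = cong (2 + a ∷_) (replaceOne-range-from-2 n (suc a) l)

replaceOne-range : ∀ n → map (replaceOne n) (range 1 (2 * n)) ↭ range 2 (2 * n)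
replaceOne-range zero = ↭-refl
replaceOne-range (suc m) =
  subst (λ L → map (replaceOne (suc m)) (range 1 L) ↭ range 2 L) (sym (*-suc 2 m)) (begin
  (2 * suc m + 1) ∷ map (replaceOne (suc m)) (range 2 (suc (2 * m)))
    ≡⟨ cong ((2 * suc m + 1) ∷_) (replaceOne-range-from-2 (suc m) 0 (suc (2 * m))) ⟩
  (2 * suc m + 1) ∷ range 2 (suc (2 * m))
    ↭⟨ ∷↭∷ʳ _ _ ⟩
  range 2 (suc (2 * m)) ∷ʳ (2 * suc m + 1)
    ≡⟨ cong (range 2 (suc (2 * m)) ∷ʳ_) last-point ⟩
  range 2 (suc (2 * m)) ∷ʳ (2 + suc (2 * m))
    ≡⟨ range-snoc 2 (suc (2 * m)) ⟨
  range 2 (2 + 2 * m) ∎)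
  where
  open PermutationReasoning
  last-point : 2 * suc m + 1 ≡ 2 + suc (2 * m)
  last-point = trans (cong (_+ 1) (*-suc 2 m)) (cong (2 +_) (+-comm (2 * m) 1))

replaceOne-bounds : ∀ n {x} → 1 ≤ x → x < 1 + 2 * n → 1 ≤ replaceOne n x × replaceOne n x ≤ 1 + 2 * n
replaceOne-bounds n {suc zero} _ _ = m≤n+m 1 (2 * n) , ≤-reflexive (+-comm (2 * n) 1)
replaceOne-bounds n {suc (suc x)} 1≤x x<1+2n = 1≤x , <⇒≤ x<1+2n

ρ-relabel : ∀ {n M} → MatchingOn n M → ρ M ≡ relabel (rotate n) M
ρ-relabel {n} {M} on = begin
  ρ M
    ≡⟨ cong (λ k → st (relabel (replaceOne k) M)) (matchingOn-length {n} {M} on) ⟩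
  relabel (rank M′) M′
    ≡⟨ map-∘ M ⟨
  relabel (λ x → rank M′ (replaceOne n x)) M
    ≡⟨ map-cong-local (All.map (λ (a-in , b-in) → cong₂ _,_ (rank-replaceOne a-in) (rank-replaceOne b-in))
                               (matchingOn-bounds {n} {M} on)) ⟩
  relabel (rotate n) M ∎
  where
  open ≡-Reasoning
  M′ : OrderedMatching
  M′ = relabel (replaceOne n) M
  support-M′ : support M′ ↭ range 2 (2 * n)
  support-M′ = ↭-trans (↭-reflexive (support-relabel (replaceOne n) M))
                       (↭-trans (map⁺ (replaceOne n) on) (replaceOne-range n))
  rank-replaceOne : ∀ {x} → 1 ≤ x × x < 1 + 2 * n → rank M′ (replaceOne n x) ≡ rotate n x
  rank-replaceOne {x} (1≤x , x<) with replaceOne-bounds n 1≤x x<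
  ... | 1≤y , y≤ = trans (count-map-↭ _ support-M′) (rank-range (2 * n) (replaceOne n x) 1≤y y≤)

rev-relabel : ∀ {n M} → MatchingOn n M → rev M ≡ relabel ((2 * n + 1) ∸_) M
rev-relabel {n} {M} on = cong (λ l → relabel ((2 * l + 1) ∸_) M) (matchingOn-length {n} {M} on)

-- Pignose matchings

⟨$⟩ʳ-injective : ∀ {n} (π : Permutation′ n) {i j} → π ⟨$⟩ʳ i ≡ π ⟨$⟩ʳ j → i ≡ j
⟨$⟩ʳ-injective π eq = trans (sym (inverseˡ π)) (trans (cong (π ⟨$⟩ˡ_) eq) (inverseˡ π))

allFin-↭ : ∀ {n} (π : Permutation′ n) → map (π ⟨$⟩ʳ_) (allFin n) ↭ allFin n
allFin-↭ {n} π = ∼bag⇒↭ (unique∧set⇒bag (Unique.map⁺ (⟨$⟩ʳ-injective π) (allFin⁺ n)) (allFin⁺ n) (mk⇔ (λ _ → ∈-allFin _) hit))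
  where
  hit : ∀ {i} → i ∈ allFin n → i ∈ map (π ⟨$⟩ʳ_) (allFin n)
  hit _ = subst (_∈ map (π ⟨$⟩ʳ_) (allFin n)) (inverseʳ π) (∈-map⁺ (π ⟨$⟩ʳ_) (∈-allFin _))

allFin-reindex : ∀ {A : Set} {n} (π : Permutation′ n) (f : Fin n → A) →
  map f (allFin n) ↭ map (λ k → f (π ⟨$⟩ˡ k)) (allFin n)
allFin-reindex π f = ↭-sym (↭-trans (↭-reflexive (map-∘ _)) (map⁺ f (allFin-↭ (flip π))))

odd even : ∀ {n} → Fin n → ℕ
odd i = 2 * toℕ i + 1
even i = 2 * suc (toℕ i)

swapped : OrderedMatching → OrderedMatching
swapped = map swap

-- Reindexing the arcs by their new odd endpoint gives the permutation.
relabel-pignose : ∀ {n} (f : ℕ → ℕ) (α β σ : Permutation′ n) →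
  (∀ i → f (odd i) ≡ even (α ⟨$⟩ʳ i)) → (∀ j → f (even j) ≡ odd (β ⟨$⟩ʳ j)) →
  relabel f (pignoseOf n σ) ↭ swapped (pignoseOf n (flip β ∘ₚ flip σ ∘ₚ α))
relabel-pignose {n} f α β σ f-odd f-even = begin
  relabel f (pignoseOf n σ)
    ≡⟨ map-∘ (allFin n) ⟨
  map (λ i → f (odd i) , f (even (σ ⟨$⟩ʳ i))) (allFin n)
    ≡⟨ map-cong (λ i → cong₂ _,_ (f-odd i) (f-even (σ ⟨$⟩ʳ i))) (allFin n) ⟩
  map (λ i → even (α ⟨$⟩ʳ i) , odd (β ⟨$⟩ʳ (σ ⟨$⟩ʳ i))) (allFin n)
    ↭⟨ allFin-reindex (σ ∘ₚ β) _ ⟩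
  map (λ k → even (τ ⟨$⟩ʳ k) , odd (β ⟨$⟩ʳ (σ ⟨$⟩ʳ (σ ⟨$⟩ˡ (β ⟨$⟩ˡ k))))) (allFin n)
    ≡⟨ map-cong (λ k → cong (λ j → even (τ ⟨$⟩ʳ k) , odd j) (trans (cong (β ⟨$⟩ʳ_) (inverseʳ σ)) (inverseʳ β)))
                (allFin n) ⟩
  map (λ k → even (τ ⟨$⟩ʳ k) , odd k) (allFin n)
    ≡⟨ map-∘ (allFin n) ⟩
  swapped (pignoseOf n τ) ∎
  where
  open PermutationReasoning
  τ : Permutation′ n
  τ = flip β ∘ₚ flip σ ∘ₚ α

relabel-swapped : ∀ f M → relabel f (swapped M) ≡ swapped (relabel f M)
relabel-swapped f M = trans (sym (map-∘ M)) (map-∘ M)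

swapped-involutive : ∀ M → swapped (swapped M) ≡ M
swapped-involutive M = trans (sym (map-∘ M)) (map-id M)

relabel-swapped-pignose : ∀ {n} (f : ℕ → ℕ) (α β σ : Permutation′ n) →
  (∀ i → f (odd i) ≡ even (α ⟨$⟩ʳ i)) → (∀ j → f (even j) ≡ odd (β ⟨$⟩ʳ j)) →
  relabel f (swapped (pignoseOf n σ)) ↭ pignoseOf n (flip β ∘ₚ flip σ ∘ₚ α)
relabel-swapped-pignose {n} f α β σ f-odd f-even =
  ↭-trans (↭-reflexive (relabel-swapped f (pignoseOf n σ)))
          (↭-trans (map⁺ swap (relabel-pignose f α β σ f-odd f-even)) (↭-reflexive (swapped-involutive _)))

cyclePred : ∀ {m} → Permutation′ (suc m)
cyclePred = lift₀ reverse ∘ₚ reverse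

toℕ-cyclePred-zero : ∀ m → toℕ (cyclePred {m} ⟨$⟩ʳ fzero) ≡ m
toℕ-cyclePred-zero m = toℕ-fromℕ m

toℕ-cyclePred-suc : ∀ {m} (k : Fin m) → toℕ (cyclePred ⟨$⟩ʳ fsuc k) ≡ toℕ k
toℕ-cyclePred-suc k = trans (toℕ-inject₁ (opposite (opposite k))) (cong toℕ (opposite-involutive k))

rotate-≥2 : ∀ n {x} → 2 ≤ x → rotate n x ≡ x ∸ 1
rotate-≥2 n {suc (suc x)} (s≤s (s≤s z≤n)) = refl

2≤even : ∀ t → 2 ≤ 2 * suc t
2≤even t = *-monoʳ-≤ 2 (s≤s z≤n)

rotate-odd : ∀ {m} (i : Fin (suc m)) → rotate (suc m) (odd i) ≡ even (cyclePred ⟨$⟩ʳ i)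
rotate-odd {m} fzero = trans (rotate-one (suc m)) (cong (λ t → 2 * suc t) (sym (toℕ-cyclePred-zero m)))
rotate-odd {m} (fsuc k) = begin
  rotate (suc m) (2 * suc (toℕ k) + 1) ≡⟨ rotate-≥2 (suc m) (≤-trans (2≤even (toℕ k)) (m≤m+n _ 1)) ⟩
  (2 * suc (toℕ k) + 1) ∸ 1            ≡⟨ m+n∸n≡m (2 * suc (toℕ k)) 1 ⟩
  2 * suc (toℕ k)                      ≡⟨ cong (λ t → 2 * suc t) (toℕ-cyclePred-suc k) ⟨
  even (cyclePred ⟨$⟩ʳ fsuc k)         ∎
  where open ≡-Reasoning

rotate-even : ∀ n {m} (j : Fin m) → rotate n (even j) ≡ odd j
rotate-even n j = begin
  rotate n (2 * suc (toℕ j)) ≡⟨ rotate-≥2 n (2≤even (toℕ j)) ⟩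
  2 * suc (toℕ j) ∸ 1        ≡⟨ cong (_∸ 1) (*-suc 2 (toℕ j)) ⟩
  suc (2 * toℕ j)            ≡⟨ +-comm 1 (2 * toℕ j) ⟩
  2 * toℕ j + 1              ∎
  where open ≡-Reasoning

toℕ+toℕ-opposite : ∀ {m} (i : Fin (suc m)) → toℕ i + toℕ (opposite i) ≡ m
toℕ+toℕ-opposite i = trans (cong (toℕ i +_) (opposite-prop i)) (m+[n∸m]≡n (≤-pred (toℕ<n i)))

reflect-odd : ∀ {m} (i : Fin (suc m)) → (2 * suc m + 1) ∸ odd i ≡ even (opposite i)
reflect-odd {m} i = begin
  (2 * suc m + 1) ∸ (2 * t + 1)           ≡⟨ cong (λ k → (2 * suc k + 1) ∸ (2 * t + 1)) (toℕ+toℕ-opposite i) ⟨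
  (2 * suc (t + u) + 1) ∸ (2 * t + 1)     ≡⟨ cong (_∸ (2 * t + 1)) (arith t u) ⟩
  ((2 * t + 1) + 2 * suc u) ∸ (2 * t + 1) ≡⟨ m+n∸m≡n (2 * t + 1) (2 * suc u) ⟩
  2 * suc u                               ∎
  where
  open ≡-Reasoning
  t u : ℕ
  t = toℕ i
  u = toℕ (opposite i)
  arith : ∀ t u → 2 * suc (t + u) + 1 ≡ (2 * t + 1) + 2 * suc u
  arith = solve-∀

reflect-even : ∀ {m} (j : Fin (suc m)) → (2 * suc m + 1) ∸ even j ≡ odd (opposite j)
reflect-even {m} j = begin
  (2 * suc m + 1) ∸ 2 * suc t             ≡⟨ cong (λ k → (2 * suc k + 1) ∸ 2 * suc t) (toℕ+toℕ-opposite j) ⟨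
  (2 * suc (t + u) + 1) ∸ 2 * suc t       ≡⟨ cong (_∸ 2 * suc t) (arith t u) ⟩
  (2 * suc t + (2 * u + 1)) ∸ 2 * suc t   ≡⟨ m+n∸m≡n (2 * suc t) (2 * u + 1) ⟩
  2 * u + 1                               ∎
  where
  open ≡-Reasoning
  t u : ℕ
  t = toℕ j
  u = toℕ (opposite j)
  arith : ∀ t u → 2 * suc (t + u) + 1 ≡ 2 * suc t + (2 * u + 1)
  arith = solve-∀

support-split : ∀ M → support M ↭ map proj₁ M ++ map proj₂ M
support-split [] = ↭-refl
support-split (p ∷ M) =
  prep (proj₁ p) (↭-trans (prep (proj₂ p) (support-split M)) (↭-sym (shift (proj₂ p) (map proj₁ M) _)))

swapped-matchingOn : ∀ {n M} → MatchingOn n M → MatchingOn n (swapped M)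
swapped-matchingOn {n} {M} on = begin
  support (swapped M)                             ↭⟨ support-split (swapped M) ⟩
  map proj₁ (swapped M) ++ map proj₂ (swapped M)  ≡⟨ cong₂ _++_ (sym (map-∘ M)) (sym (map-∘ M)) ⟩
  map proj₂ M ++ map proj₁ M                      ↭⟨ ++-comm (map proj₂ M) _ ⟩
  map proj₁ M ++ map proj₂ M                      ↭⟨ support-split M ⟨
  support M                                       ↭⟨ on ⟩
  range 1 (2 * n)                                 ∎
  where open PermutationReasoning

map-allFin : ∀ {A : Set} n (h : ℕ → A) → map (λ i → h (toℕ i)) (allFin n) ≡ map h (range 0 n)
map-allFin n h = trans (map-tabulate (λ i → i) _) (from n 0)
  where
  from : ∀ n a → tabulate {n = n} (λ i → h (a + toℕ i)) ≡ map h (range a n)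
  from zero a = refl
  from (suc n) a =
    cong₂ _∷_ (cong h (+-identityʳ a)) (trans (tabulate-cong (λ i → cong h (+-suc a (toℕ i)))) (from n (suc a)))

support-consecutive : ∀ a l →
  support (map (λ x → 2 * x + 1 , 2 * suc x) (range a l)) ≡ range (2 * a + 1) (2 * l)
support-consecutive a zero = refl
support-consecutive a (suc l) = begin
  2 * a + 1 ∷ 2 * suc a ∷ support (map (λ x → 2 * x + 1 , 2 * suc x) (range (suc a) l))
    ≡⟨ cong₂ (λ x xs → 2 * a + 1 ∷ x ∷ xs) next
             (trans (support-consecutive (suc a) l) (cong (λ b → range b (2 * l)) next-next)) ⟩
  range (2 * a + 1) (2 + 2 * l)
    ≡⟨ cong (range (2 * a + 1)) (*-suc 2 l) ⟨
  range (2 * a + 1) (2 * suc l) ∎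
  where
  open ≡-Reasoning
  next : 2 * suc a ≡ suc (2 * a + 1)
  next = trans (*-suc 2 a) (cong suc (+-comm 1 (2 * a)))
  next-next : 2 * suc a + 1 ≡ suc (suc (2 * a + 1))
  next-next = trans (cong (_+ 1) next) (+-comm (suc (2 * a + 1)) 1)

pignose-matchingOn : ∀ n σ → MatchingOn n (pignoseOf n σ)
pignose-matchingOn n σ = begin
  support (pignoseOf n σ)
    ↭⟨ support-split (pignoseOf n σ) ⟩
  map proj₁ (pignoseOf n σ) ++ map proj₂ (pignoseOf n σ)
    ≡⟨ cong₂ _++_ (sym (map-∘ (allFin n))) (trans (sym (map-∘ (allFin n))) (map-∘ (allFin n))) ⟩
  map odd (allFin n) ++ map even (map (σ ⟨$⟩ʳ_) (allFin n))
    ↭⟨ ++⁺ˡ (map odd (allFin n)) (map⁺ even (allFin-↭ σ)) ⟩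
  map odd (allFin n) ++ map even (allFin n)
    ≡⟨ cong₂ _++_ (map-∘ (allFin n)) (map-∘ (allFin n)) ⟩
  map proj₁ consecutive ++ map proj₂ consecutive
    ↭⟨ support-split consecutive ⟨
  support consecutive
    ≡⟨ cong support (map-allFin n (λ x → 2 * x + 1 , 2 * suc x)) ⟩
  support (map (λ x → 2 * x + 1 , 2 * suc x) (range 0 n))
    ≡⟨ support-consecutive 0 n ⟩
  range 1 (2 * n) ∎
  where
  open PermutationReasoning
  consecutive : OrderedMatching
  consecutive = map (λ i → odd i , even i) (allFin n)

cro-swapped : ∀ {M} → All (λ p → proj₁ p ≢ proj₂ p) M → cro (swapped M) ≡ cro M
cro-swapped = cro-map _ swap crosses-swap

cro-reflect : ∀ K {M} → All (λ p → proj₁ p ≢ proj₂ p × proj₁ p ≤ K × proj₂ p ≤ K) M →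
  cro (relabel (K ∸_) M) ≡ cro M
cro-reflect K = cro-map _ _ (λ (a≢b , a≤K , b≤K) (c≢d , c≤K , d≤K) → crosses-reflect a≢b c≢d a≤K b≤K c≤K d≤K)

parity-2* : ∀ t → parity (2 * t) ≡ 0ℙ
parity-2* t = *-homo-* 2 t

parity-2*+1 : ∀ t → parity (2 * t + 1) ≡ 1ℙ
parity-2*+1 t = trans (+-homo-+ (2 * t) 1) (cong (ℙ._+ 1ℙ) (parity-2* t))

odd≢even : ∀ {m n} (i : Fin m) (j : Fin n) → odd i ≢ even j
odd≢even i j eq with trans (sym (parity-2*+1 (toℕ i))) (trans (cong parity eq) (parity-2* (suc (toℕ j))))
... | ()

odd<even : ∀ {x y} → x < y → 2 * x + 1 < 2 * y
odd<even {x} x<y = ≤-trans (≤-reflexive (trans (cong suc (+-comm (2 * x) 1)) (sym (*-suc 2 x)))) (*-monoʳ-≤ 2 x<y)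

odd<even⁻¹ : ∀ {x y} → 2 * x + 1 < 2 * y → x < y
odd<even⁻¹ {x} {y} lt = *-cancelˡ-< 2 x y (<-trans (m<m+n (2 * x) (s≤s z≤n)) lt)

odd≤ : ∀ {n} (i : Fin n) → odd i ≤ 2 * n
odd≤ i = <⇒≤ (odd<even (toℕ<n i))

even≤ : ∀ {n} (j : Fin n) → even j ≤ 2 * n
even≤ j = *-monoʳ-≤ 2 (toℕ<n j)

pignose-arcs : ∀ n σ →
  All (λ p → proj₁ p ≢ proj₂ p × proj₁ p ≤ 2 * n × proj₂ p ≤ 2 * n) (pignoseOf n σ)
pignose-arcs n σ = All.map⁺ (All.tabulate⁺ (λ i → odd≢even i (σ ⟨$⟩ʳ i) , odd≤ i , even≤ (σ ⟨$⟩ʳ i)))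

map-tabulate-suc : ∀ {A : Set} {n} (f : Fin (suc n) → A) →
  map f (tabulate fsuc) ≡ map (λ i → f (fsuc i)) (allFin n)
map-tabulate-suc f = trans (map-tabulate fsuc f) (sym (map-tabulate (λ i → i) _))

count-false : ∀ {A : Set} (xs : List A) → count (map (λ _ → false) xs) ≡ 0
count-false [] = refl
count-false (x ∷ xs) = count-false xs

count-allFin-< : ∀ {n t} → t ≤ n → count (map (λ i → toℕ i <ᵇ t) (allFin n)) ≡ t
count-allFin-< {zero} z≤n = refl
count-allFin-< {suc n} {zero} _ =
  trans (cong count (map-tabulate-suc {n = n} (λ i → toℕ i <ᵇ 0))) (count-false (allFin n))
count-allFin-< {suc n} {suc t} (s≤s t≤n) =
  cong suc (trans (cong count (map-tabulate-suc {n = n} (λ i → toℕ i <ᵇ suc t))) (count-allFin-< t≤n))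

even-injective : ∀ {n} {i j : Fin n} → even i ≡ even j → i ≡ j
even-injective {i = i} {j} eq = toℕ-injective (suc-injective (*-cancelˡ-≡ (suc (toℕ i)) (suc (toℕ j)) 2 eq))

ρ-perm : ∀ {m} → Permutation′ (suc m) → Permutation′ (suc m)
ρ-perm σ = flip idₚ ∘ₚ flip σ ∘ₚ cyclePred

rev-perm : ∀ {m} → Permutation′ (suc m) → Permutation′ (suc m)
rev-perm σ = flip reverse ∘ₚ flip σ ∘ₚ reverse

module _ {m : ℕ} (σ : Permutation′ (suc m)) where

  private
    n a Y : ℕ
    n = suc m
    a = toℕ (σ ⟨$⟩ʳ fzero)
    Y = even (σ ⟨$⟩ʳ fzero)
    P R : OrderedMatching
    P = pignoseOf n σ
    R = map (λ i → odd i , even (σ ⟨$⟩ʳ i)) (tabulate {n = m} fsuc)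
    P-on : MatchingOn n P
    P-on = pignose-matchingOn n σ
    swapped-P-on : MatchingOn n (swapped P)
    swapped-P-on = swapped-matchingOn {n} {P} P-on

  ρ-pignose : ρ P ↭ swapped (pignoseOf n (ρ-perm σ))
  ρ-pignose = ↭-trans (↭-reflexive (ρ-relabel {n} {P} P-on))
                      (relabel-pignose (rotate n) cyclePred idₚ σ rotate-odd (rotate-even n))

  ρ-swapped-pignose : ρ (swapped P) ↭ pignoseOf n (ρ-perm σ)
  ρ-swapped-pignose = ↭-trans (↭-reflexive (ρ-relabel {n} {swapped P} swapped-P-on))
                              (relabel-swapped-pignose (rotate n) cyclePred idₚ σ rotate-odd (rotate-even n))

  rev-swapped-pignose : rev (swapped P) ↭ pignoseOf n (rev-perm σ)
  rev-swapped-pignose = ↭-trans (↭-reflexive (rev-relabel {n} {swapped P} swapped-P-on))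
                                (relabel-swapped-pignose ((2 * n + 1) ∸_) reverse reverse σ reflect-odd reflect-even)

  private
    starts-below : count (map (λ r → proj₁ r <ᵇ Y) R) ≡ a
    starts-below = begin
      count (map (λ r → proj₁ r <ᵇ Y) R)
        ≡⟨ cong count (map-∘ {g = λ r → proj₁ r <ᵇ Y} {f = λ i → odd i , even (σ ⟨$⟩ʳ i)} (tabulate fsuc)) ⟨
      count (map (λ i → odd i <ᵇ Y) (tabulate {n = m} fsuc))
        ≡⟨ cong count (map-tabulate-suc {n = m} (λ i → odd i <ᵇ Y)) ⟩
      count (map (λ k → odd (fsuc k) <ᵇ Y) (allFin m))
        ≡⟨ cong count (map-cong (λ k → <ᵇ-cong {c = toℕ k} {a} (λ lt → ≤-pred (odd<even⁻¹ lt)) (λ lt → odd<even (s≤s lt)))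
                                (allFin m)) ⟩
      count (map (λ k → toℕ k <ᵇ a) (allFin m))
        ≡⟨ count-allFin-< (≤-pred (toℕ<n (σ ⟨$⟩ʳ fzero))) ⟩
      a ∎
      where open ≡-Reasoning

    ends-below : count (map (λ r → proj₂ r <ᵇ Y) R) ≡ a
    ends-below = begin
      count (map (λ r → proj₂ r <ᵇ Y) R)
        ≡⟨ cong (λ b → count (b ∷ map (λ r → proj₂ r <ᵇ Y) R)) (<ᵇ-false (≤-refl {Y})) ⟨
      count (map (λ r → proj₂ r <ᵇ Y) P)
        ≡⟨ cong count (map-∘ {g = λ r → proj₂ r <ᵇ Y} {f = λ i → odd i , even (σ ⟨$⟩ʳ i)} (allFin n)) ⟨
      count (map (λ i → even (σ ⟨$⟩ʳ i) <ᵇ Y) (allFin n))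
        ≡⟨ cong count (map-∘ {g = λ j → even j <ᵇ Y} {f = σ ⟨$⟩ʳ_} (allFin n)) ⟩
      count (map (λ j → even j <ᵇ Y) (map (σ ⟨$⟩ʳ_) (allFin n)))
        ≡⟨ count-map-↭ (λ j → even j <ᵇ Y) (allFin-↭ σ) ⟩
      count (map (λ j → even j <ᵇ Y) (allFin n))
        ≡⟨ cong count (map-cong (λ j → <ᵇ-cong {c = toℕ j} {a} (λ lt → ≤-pred (*-cancelˡ-< 2 _ _ lt)) (λ lt → *-monoʳ-< 2 (s≤s lt)))
                                (allFin n)) ⟩
      count (map (λ j → toℕ j <ᵇ a) (allFin n))
        ≡⟨ count-allFin-< (<⇒≤ (toℕ<n (σ ⟨$⟩ʳ fzero))) ⟩
      a ∎
      where open ≡-Reasoning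

    inner : All (Both (InnerPoint n Y)) R
    inner = All.map⁺ (All.tabulate⁺ λ k →
      (≤-trans (2≤even (toℕ k)) (m≤m+n _ 1) , odd≤ (fsuc k) , odd≢even (fsuc k) (σ ⟨$⟩ʳ fzero)) ,
      (2≤even _ , even≤ _ , λ eq → case ⟨$⟩ʳ-injective σ (even-injective eq) of λ ()))

  -- P computes to (1 , Y) ∷ R.
  cro-ρ-pignose : cro (ρ P) ≡ cro P
  cro-ρ-pignose = trans (cong cro (ρ-relabel {n} {P} P-on))
                        (cro-rotate n R (2≤even a) (even≤ (σ ⟨$⟩ʳ fzero)) inner (trans starts-below (sym ends-below)))

  cro-ρ-perm : cro (pignoseOf n (ρ-perm σ)) ≡ cro P
  cro-ρ-perm = begin
    cro (pignoseOf n (ρ-perm σ))           ≡⟨ cro-swapped (All.map proj₁ (pignose-arcs n (ρ-perm σ))) ⟨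
    cro (swapped (pignoseOf n (ρ-perm σ))) ≡⟨ cro-↭ ρ-pignose ⟨
    cro (ρ P)                               ≡⟨ cro-ρ-pignose ⟩
    cro P                                   ∎
    where open ≡-Reasoning

  cro-rev-perm : cro (pignoseOf n (rev-perm σ)) ≡ cro P
  cro-rev-perm = begin
    cro (pignoseOf n (rev-perm σ))            ≡⟨ cro-↭ rev-swapped-pignose ⟨
    cro (rev (swapped P))                     ≡⟨ cong cro (rev-relabel {n} {swapped P} swapped-P-on) ⟩
    cro (relabel ((2 * n + 1) ∸_) (swapped P)) ≡⟨ cro-reflect (2 * n + 1) (All.map⁺ (All.map bounded (pignose-arcs n σ))) ⟩
    cro (swapped P)                           ≡⟨ cro-swapped (All.map proj₁ (pignose-arcs n σ)) ⟩
    cro P                                     ∎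
    where
    open ≡-Reasoning
    bounded : ∀ {p} → proj₁ p ≢ proj₂ p × proj₁ p ≤ 2 * n × proj₂ p ≤ 2 * n →
      proj₂ p ≢ proj₁ p × proj₂ p ≤ 2 * n + 1 × proj₁ p ≤ 2 * n + 1
    bounded (a≢b , a≤ , b≤) = (λ eq → a≢b (sym eq)) , ≤-trans b≤ (m≤m+n _ 1) , ≤-trans a≤ (m≤m+n _ 1)

iterate-odd : ∀ {m} k (σ : Permutation′ (suc m)) →
  iter (2 * k + 1) ρ (pignoseOf (suc m) σ) ↭ swapped (pignoseOf (suc m) (iter (2 * k + 1) ρ-perm σ))
iterate-odd zero σ = ρ-pignose σ
iterate-odd {m} (suc k) σ =
  subst (λ j → iter j ρ (pignoseOf (suc m) σ) ↭ swapped (pignoseOf (suc m) (iter j ρ-perm σ))) (sym two-more) (begin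
    ρ (ρ (iter (2 * k + 1) ρ (pignoseOf (suc m) σ))) ↭⟨ ρ-↭ (ρ-↭ (iterate-odd k σ)) ⟩
    ρ (ρ (swapped (pignoseOf (suc m) τ)))           ↭⟨ ρ-↭ (ρ-swapped-pignose τ) ⟩
    ρ (pignoseOf (suc m) (ρ-perm τ))                 ↭⟨ ρ-pignose (ρ-perm τ) ⟩
    swapped (pignoseOf (suc m) (ρ-perm (ρ-perm τ))) ∎)
  where
  open PermutationReasoning
  τ : Permutation′ (suc m)
  τ = iter (2 * k + 1) ρ-perm σ
  two-more : 2 * suc k + 1 ≡ 2 + (2 * k + 1)
  two-more = cong (_+ 1) (*-suc 2 k)

cro-iterate : ∀ {m} j (σ : Permutation′ (suc m)) →
  cro (pignoseOf (suc m) (iter j ρ-perm σ)) ≡ cro (pignoseOf (suc m) σ)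
cro-iterate zero σ = refl
cro-iterate (suc j) σ = trans (cro-ρ-perm (iter j ρ-perm σ)) (cro-iterate j σ)

lemma3p9 : (n : ℕ) → 1 ≤ n → (M : OrderedMatching) → IsPignose n M → (k : ℕ)
    → IsPignose n (rev (iter (2 * k + 1) ρ M))
    × cro (rev (iter (2 * k + 1) ρ M)) ≡ cro M
lemma3p9 (suc m) _ M (σ , M↭P) k = (rev-perm τ , N↭) , (begin
  cro N                                 ≡⟨ cro-↭ N↭ ⟩
  cro (pignoseOf (suc m) (rev-perm τ)) ≡⟨ cro-rev-perm τ ⟩
  cro (pignoseOf (suc m) τ)            ≡⟨ cro-iterate (2 * k + 1) σ ⟩
  cro (pignoseOf (suc m) σ)            ≡⟨ cro-↭ M↭P ⟨
  cro M                                 ∎)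
  where
  open ≡-Reasoning
  τ : Permutation′ (suc m)
  τ = iter (2 * k + 1) ρ-perm σ
  N : OrderedMatching
  N = rev (iter (2 * k + 1) ρ M)
  N↭ : N ↭ pignoseOf (suc m) (rev-perm τ)
  N↭ = ↭-trans (rev-↭ (↭-trans (iter-ρ-↭ (2 * k + 1) M↭P) (iterate-odd k σ))) (rev-swapped-pignose τ)
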